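{- Let $A$ and $B$ be sets with $|A| = k \geq 3$ and $|B| \geq 2$. Then for every $n \geq k+1$ there exists a function $f \colon A^n \to B$ that is determined by $\mathrm{cs}$, that is not similar to any function $A^n \to B$ determined by $\mathrm{ofo}$, and that is not $2$-set-transitive.
   Context: For $\mathbf{a}\in A^n$ and $\sigma\in S_n$, $\mathbf{a}\sigma := (a_{\sigma(1)},\dots,a_{\sigma(n)})$. $f,g\colon A^n\to B$ are similar if $f(\mathbf{a}) = g(\mathbf{a}\sigma)$ for all $\mathbf{a}$, for some $\sigma\in S_n$. The content $\mathrm{ms}(\mathbf{a})$ is the multiset of entries of $\mathbf{a}$; a singleton of $\mathbf{a}$ is an element occurring exactly once in $\mathbf{a}$; $\mathrm{singles}(\mathbf{a})$ lists the singletons of $\mathbf{a}$ in their order of occurrence; $\mathrm{cs}(\mathbf{a}) := (\mathrm{ms}(\mathbf{a}),\mathrm{singles}(\mathbf{a}))$. $\mathrm{ofo}(\mathbf{a})$ is the tuple obtained from $\mathbf{a}$ by deleting all repeated occurrences of symbols, keeping only the first occurrence of each symbol. For $\phi \in \{\mathrm{cs},\mathrm{ofo}\}$, $f\colon A^n\to B$ is determined by $\phi$ if $f(\mathbf{a}) = f(\mathbf{b})$ whenever $\phi(\mathbf{a})=\phi(\mathbf{b})$. The invariance group of $f$ is $\mathrm{Inv} f := \{\sigma\in S_n : f(\mathbf{a}\sigma) = f(\mathbf{a}) \text{ for all } \mathbf{a}\in A^n\}$; $f$ is $2$-set-transitive if $\mathrm{Inv} f$ acts transitively on the $2$-element subsets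 of $\{1,\dots,n\}$. -}

module Defs where

open import Data.Nat using (ℕ)
open import Data.Fin using (Fin)
open import Data.Fin.Permutation using (Permutation′; _⟨$⟩ʳ_)
open import Data.List using (List; filter; length; deduplicate)
open import Data.Vec.Functional using (toList)
open import Data.Product using (Σ; _×_)
open import Data.Sum using (_⊎_)
open import Function using (_∘_)
open import Relation.Binary.Definitions using (DecidableEquality)
open import Relation.Binary.PropositionalEquality using (_≡_; _≢_)
open import Data.List.Relation.Binary.Permutation.Propositional using (_↭_)
open import Data.Nat.Properties using () renaming (_≟_ to _≟ℕ_)

-- Tuples in A^n are functions Fin n → A (coordinates 1..n ↦ 0..n-1).
Tuple : Set → ℕ → Set
Tuple A n = Fin n → A

_·_ : ∀ {A n} → Tuple A n → Permutation′ n → Tuple A n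
(a · σ) i = a (σ ⟨$⟩ʳ i)

module _ {A : Set} (_≟_ : DecidableEquality A) where

  count : A → List A → ℕ
  count x xs = length (filter (λ y → x ≟ y) xs)

  singles : ∀ {n} → Tuple A n → List A
  singles a = filter (λ x → count x (toList a) ≟ℕ 1) (toList a)

  ofo : ∀ {n} → Tuple A n → List A
  ofo a = deduplicate _≟_ (toList a)

  -- cs(a) = cs(b): equal content multisets (bag equality of entry lists)
  -- and equal singles lists
  SameCs : ∀ {n} → Tuple A n → Tuple A n → Set
  SameCs a b = (toList a ↭ toList b) × (singles a ≡ singles b)

  DeterminedByCs : ∀ {n} {B : Set} → (Tuple A n → B) → Set
  DeterminedByCs {n} f = (a b : Tuple A n) → SameCs a b → f a ≡ f b

  DeterminedByOfo : ∀ {n} {B : Set} → (Tuple A n → B) → Set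
  DeterminedByOfo {n} f = (a b : Tuple A n) → ofo a ≡ ofo b → f a ≡ f b

Similar : ∀ {A B : Set} {n} → (Tuple A n → B) → (Tuple A n → B) → Set
Similar {A} {B} {n} f g = Σ (Permutation′ n) λ σ → (a : Tuple A n) → f a ≡ g (a · σ)

InInv : ∀ {A B : Set} {n} → (Tuple A n → B) → Permutation′ n → Set
InInv {A} {B} {n} f σ = (a : Tuple A n) → f (a · σ) ≡ f a

TwoSetTransitive : ∀ {A B : Set} {n} → (Tuple A n → B) → Set
TwoSetTransitive {A} {B} {n} f =
  (i j i′ j′ : Fin n) → i ≢ j → i′ ≢ j′ →
  Σ (Permutation′ n) λ σ → InInv f σ ×
    (((σ ⟨$⟩ʳ i ≡ i′) × (σ ⟨$⟩ʳ j ≡ j′)) ⊎ ((σ ⟨$⟩ʳ i ≡ j′) × (σ ⟨$⟩ʳ j ≡ i′)))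

-- Take distinct x, y, z ∈ A and let f a be b₁ exactly when the first singleton of a
-- lying in {x, y} is x. It depends only on singles a, hence on cs a.
-- On the tuple with x at p, y at q and z elsewhere, f records whether p < q;
-- relabelling positions by a σ that reverses some pair would flip this value, so
-- every σ ∈ Inv f is strictly increasing, and no such σ maps the pair of
-- positions {2,3} onto {1,2}.
-- The tuples (x,z,z,…) and (x,x,z,…) have the same ofo but different f-values;
-- if f a = g (a σ) with g determined by ofo, applying this to both tuples
-- relabelled by σ⁻¹ gives a contradiction.
module Submission where

open import Defs
open import Data.Nat using (ℕ; _≤_; suc; zero; z≤n; s≤s; s<s)
open import Data.Nat.Properties using (n≮0; <-irrefl) renaming (_≟_ to _≟ℕ_)
open import Data.Fin using (Fin; _<_) renaming (zero to fzero; suc to fsuc)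
open import Data.Fin.Properties
  using (inj⇒≟; <⇒≢; <-cmp; <-trans; suc-injective; 0≢1+n) renaming (_≟_ to _≟F_)
open import Data.Fin.Permutation using (Permutation′; _⟨$⟩ʳ_; _⟨$⟩ˡ_; inverseˡ; inverseʳ; flip)
open import Function.Bundles using (_↔_; Inverse; Injection)
open import Function.Properties.Inverse using (↔⇒↣; ↔-sym)
open import Data.Product using (Σ; _×_; _,_)
open import Data.Sum using (inj₁; inj₂)
open import Data.Empty using (⊥-elim)
open import Data.List using (List; []; _∷_; filter; tabulate; deduplicate)
open import Data.List.Properties using (filter-accept; filter-reject; filter-idem; tabulate-cong)
open import Data.Vec.Functional using (toList)
open import Relation.Binary.PropositionalEquality
open import Relation.Binary.Definitions using (DecidableEquality; tri<; tri≈; tri>)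
open import Relation.Nullary using (¬_; Dec; yes; no; ¬?)
open import Relation.Unary using (Pred; Decidable)
open import Level using (0ℓ)
open import Function using (_∘_)

permutation-injective : ∀ {n} (σ : Permutation′ n) {i j} → σ ⟨$⟩ʳ i ≡ σ ⟨$⟩ʳ j → i ≡ j
permutation-injective σ = Injection.injective (↔⇒↣ σ)

module _ {A : Set} (_≟_ : DecidableEquality A) where

  deduplicate-stutter : ∀ v l → deduplicate _≟_ (v ∷ v ∷ l) ≡ deduplicate _≟_ (v ∷ l)
  deduplicate-stutter v l = cong (v ∷_) (begin
    filter v≢? (v ∷ filter v≢? (deduplicate _≟_ l)) ≡⟨ filter-reject v≢? (λ v≢v → v≢v refl) ⟩
    filter v≢? (filter v≢? (deduplicate _≟_ l))     ≡⟨ filter-idem v≢? (deduplicate _≟_ l) ⟩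
    filter v≢? (deduplicate _≟_ l)                  ∎)
    where
    open ≡-Reasoning
    v≢? : Decidable (v ≢_)
    v≢? = ¬? ∘ (v ≟_)

  deduplicate-∷-cong : ∀ v {l l′} → deduplicate _≟_ l ≡ deduplicate _≟_ l′ →
    deduplicate _≟_ (v ∷ l) ≡ deduplicate _≟_ (v ∷ l′)
  deduplicate-∷-cong v = cong (λ r → v ∷ filter (¬? ∘ (v ≟_)) r)

  count-tabulate-absent : ∀ {m} (t : Fin m → A) {v} → (∀ i → t i ≢ v) →
    count _≟_ v (tabulate t) ≡ 0
  count-tabulate-absent {zero}  t     absent = refl
  count-tabulate-absent {suc m} t {v} absent with v ≟ t fzero
  ... | yes v≡t0 = ⊥-elim (absent fzero (sym v≡t0))
  ... | no _     = count-tabulate-absent (t ∘ fsuc) (absent ∘ fsuc)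

  count-tabulate-unique : ∀ {m} (t : Fin m → A) {v} p → t p ≡ v → (∀ i → t i ≡ v → i ≡ p) →
    count _≟_ v (tabulate t) ≡ 1
  count-tabulate-unique t {v} fzero tp≡v unique with v ≟ t fzero
  ... | yes _   = cong suc (count-tabulate-absent (t ∘ fsuc) (λ i → 0≢1+n ∘ sym ∘ unique (fsuc i)))
  ... | no v≢t0 = ⊥-elim (v≢t0 (sym tp≡v))
  count-tabulate-unique t {v} (fsuc p) tp≡v unique with v ≟ t fzero
  ... | yes v≡t0 = ⊥-elim (0≢1+n (unique fzero (sym v≡t0)))
  ... | no _     = count-tabulate-unique (t ∘ fsuc) p tp≡v (λ i → suc-injective ∘ unique (fsuc i))

  count-tabulate-≥1 : ∀ {m} (t : Fin m → A) {v} p → t p ≡ v → 1 ≤ count _≟_ v (tabulate t)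
  count-tabulate-≥1 t {v} fzero tp≡v with v ≟ t fzero
  ... | yes _   = s≤s z≤n
  ... | no v≢t0 = ⊥-elim (v≢t0 (sym tp≡v))
  count-tabulate-≥1 t {v} (fsuc p) tp≡v with v ≟ t fzero
  ... | yes _ = s≤s z≤n
  ... | no _  = count-tabulate-≥1 (t ∘ fsuc) p tp≡v

  count-tabulate-≥2 : ∀ {m} (t : Fin m → A) {v} p q → t p ≡ v → t q ≡ v → p ≢ q →
    2 ≤ count _≟_ v (tabulate t)
  count-tabulate-≥2 t fzero fzero _ _ p≢q = ⊥-elim (p≢q refl)
  count-tabulate-≥2 t {v} fzero (fsuc q) tp≡v tq≡v _ with v ≟ t fzero
  ... | yes _   = s≤s (count-tabulate-≥1 (t ∘ fsuc) q tq≡v)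
  ... | no v≢t0 = ⊥-elim (v≢t0 (sym tp≡v))
  count-tabulate-≥2 t {v} (fsuc p) fzero tp≡v tq≡v _ with v ≟ t fzero
  ... | yes _   = s≤s (count-tabulate-≥1 (t ∘ fsuc) p tp≡v)
  ... | no v≢t0 = ⊥-elim (v≢t0 (sym tq≡v))
  count-tabulate-≥2 t {v} (fsuc p) (fsuc q) tp≡v tq≡v p≢q with v ≟ t fzero
  ... | yes _ = s≤s (count-tabulate-≥1 (t ∘ fsuc) p tp≡v)
  ... | no _  = count-tabulate-≥2 (t ∘ fsuc) p q tp≡v tq≡v (p≢q ∘ cong fsuc)

module Construction {A B : Set} (_≟_ : DecidableEquality A)
  {b₀ b₁ : B} (b₀≢b₁ : b₀ ≢ b₁) {x y z : A} (x≢y : x ≢ y) (x≢z : x ≢ z) (y≢z : y ≢ z) where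

  xBeforeY : List A → B
  xBeforeY [] = b₀
  xBeforeY (h ∷ l) with h ≟ x | h ≟ y
  ... | yes _ | _     = b₁
  ... | no _  | yes _ = b₀
  ... | no _  | no _  = xBeforeY l

  Avoids : A → Set
  Avoids h = h ≢ x × h ≢ y

  xBeforeY-x∷ : ∀ l → xBeforeY (x ∷ l) ≡ b₁
  xBeforeY-x∷ l with x ≟ x
  ... | yes _   = refl
  ... | no x≢x  = ⊥-elim (x≢x refl)

  xBeforeY-y∷ : ∀ l → xBeforeY (y ∷ l) ≡ b₀
  xBeforeY-y∷ l with y ≟ x | y ≟ y
  ... | yes y≡x | _       = ⊥-elim (x≢y (sym y≡x))
  ... | no _    | yes _   = refl
  ... | no _    | no y≢y  = ⊥-elim (y≢y refl)

  xBeforeY-avoids∷ : ∀ {h} l → Avoids h → xBeforeY (h ∷ l) ≡ xBeforeY l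
  xBeforeY-avoids∷ {h} l (h≢x , h≢y) with h ≟ x | h ≟ y
  ... | yes h≡x | _       = ⊥-elim (h≢x h≡x)
  ... | no _    | yes h≡y = ⊥-elim (h≢y h≡y)
  ... | no _    | no _    = refl

  module _ {P : Pred A 0ℓ} (P? : Decidable P) where

    xBeforeY-filter-avoids∷ : ∀ {h} l → Avoids h →
      xBeforeY (filter P? (h ∷ l)) ≡ xBeforeY (filter P? l)
    xBeforeY-filter-avoids∷ {h} l avoids with P? h
    ... | yes _ = xBeforeY-avoids∷ (filter P? l) avoids
    ... | no _  = refl

    xBeforeY-filter-tabulate-first : ∀ {m} (t : Fin m → A) p {h c} → t p ≡ h → P h →
      (∀ l → xBeforeY (h ∷ l) ≡ c) → (∀ i → i < p → Avoids (t i)) →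
      xBeforeY (filter P? (tabulate t)) ≡ c
    xBeforeY-filter-tabulate-first t fzero refl Ph decides _ =
      trans (cong xBeforeY (filter-accept P? Ph)) (decides _)
    xBeforeY-filter-tabulate-first t (fsuc p) tp≡h Ph decides before =
      trans (xBeforeY-filter-avoids∷ _ (before fzero (s≤s z≤n)))
            (xBeforeY-filter-tabulate-first (t ∘ fsuc) p tp≡h Ph decides
              (λ i i<p → before (fsuc i) (s<s i<p)))

    xBeforeY-filter-tabulate-none : ∀ {m} (t : Fin m → A) → (∀ i → P (t i) → Avoids (t i)) →
      xBeforeY (filter P? (tabulate t)) ≡ b₀
    xBeforeY-filter-tabulate-none {zero}  t _ = refl
    xBeforeY-filter-tabulate-none {suc m} t avoids with P? (t fzero)
    ... | yes Pt0 = trans (xBeforeY-avoids∷ _ (avoids fzero Pt0))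
                          (xBeforeY-filter-tabulate-none (t ∘ fsuc) (avoids ∘ fsuc))
    ... | no _    = xBeforeY-filter-tabulate-none (t ∘ fsuc) (avoids ∘ fsuc)

  f : ∀ {n} → Tuple A n → B
  f a = xBeforeY (singles _≟_ a)

  f-determinedByCs : ∀ {n} → DeterminedByCs _≟_ (f {n})
  f-determinedByCs _ _ (_ , same-singles) = cong xBeforeY same-singles

  f-cong : ∀ {n} {a b : Tuple A n} → (∀ i → a i ≡ b i) → f a ≡ f b
  f-cong a≗b = cong (λ l → xBeforeY (filter (λ w → count _≟_ w l ≟ℕ 1) l)) (tabulate-cong a≗b)

  f-firstX : ∀ {n} (a : Tuple A n) p → a p ≡ x → (∀ i → a i ≡ x → i ≡ p) →
    (∀ i → i < p → a i ≢ y) → f a ≡ b₁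
  f-firstX a p ap≡x unique noY =
    xBeforeY-filter-tabulate-first _ a p ap≡x (count-tabulate-unique _≟_ a p ap≡x unique) xBeforeY-x∷
      (λ i i<p → (<⇒≢ i<p ∘ unique i) , noY i i<p)

  f-firstY : ∀ {n} (a : Tuple A n) p → a p ≡ y → (∀ i → a i ≡ y → i ≡ p) →
    (∀ i → i < p → a i ≢ x) → f a ≡ b₀
  f-firstY a p ap≡y unique noX =
    xBeforeY-filter-tabulate-first _ a p ap≡y (count-tabulate-unique _≟_ a p ap≡y unique) xBeforeY-y∷
      (λ i i<p → noX i i<p , (<⇒≢ i<p ∘ unique i))

  f-repeatedX : ∀ {n} (a : Tuple A n) p q → a p ≡ x → a q ≡ x → p ≢ q →
    (∀ i → a i ≢ y) → f a ≡ b₀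
  f-repeatedX a p q ap≡x aq≡x p≢q noY =
    xBeforeY-filter-tabulate-none _ a (λ i singleton → x-not-singleton i singleton , noY i)
    where
    x-repeated : 2 ≤ count _≟_ x (toList a)
    x-repeated = count-tabulate-≥2 _≟_ a p q ap≡x aq≡x p≢q
    x-not-singleton : ∀ i → count _≟_ (a i) (toList a) ≡ 1 → a i ≢ x
    x-not-singleton i singleton ai≡x =
      <-irrefl refl (subst (2 ≤_) singleton
        (subst (λ v → 2 ≤ count _≟_ v (toList a)) (sym ai≡x) x-repeated))

  pick : ∀ {n} → Fin n → Fin n → Tuple A n
  pick p q i with i ≟F p | i ≟F q
  ... | yes _ | _     = x
  ... | no _  | yes _ = y
  ... | no _  | no _  = z

  module _ {n} (p q : Fin n) where

    pick-at-p : pick p q p ≡ x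
    pick-at-p with p ≟F p
    ... | yes _   = refl
    ... | no p≢p  = ⊥-elim (p≢p refl)

    pick-at-q : q ≢ p → pick p q q ≡ y
    pick-at-q q≢p with q ≟F p | q ≟F q
    ... | yes q≡p | _      = ⊥-elim (q≢p q≡p)
    ... | no _    | yes _  = refl
    ... | no _    | no q≢q = ⊥-elim (q≢q refl)

    pick-elsewhere : ∀ {i} → i ≢ p → i ≢ q → pick p q i ≡ z
    pick-elsewhere {i} i≢p i≢q with i ≟F p | i ≟F q
    ... | yes i≡p | _       = ⊥-elim (i≢p i≡p)
    ... | no _    | yes i≡q = ⊥-elim (i≢q i≡q)
    ... | no _    | no _    = refl

    pick-x : ∀ i → pick p q i ≡ x → i ≡ p
    pick-x i pick≡x with i ≟F p | i ≟F q
    ... | yes i≡p | _     = i≡p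
    ... | no _    | yes _ = ⊥-elim (x≢y (sym pick≡x))
    ... | no _    | no _  = ⊥-elim (x≢z (sym pick≡x))

    pick-y : ∀ i → pick p q i ≡ y → i ≡ q
    pick-y i pick≡y with i ≟F p | i ≟F q
    ... | yes _ | _       = ⊥-elim (x≢y pick≡y)
    ... | no _  | yes i≡q = i≡q
    ... | no _  | no _    = ⊥-elim (y≢z (sym pick≡y))

  pick-relabel : ∀ {n} (σ : Permutation′ n) p q i →
    pick (σ ⟨$⟩ʳ p) (σ ⟨$⟩ʳ q) (σ ⟨$⟩ʳ i) ≡ pick p q i
  pick-relabel σ p q i = by-cases (i ≟F p) (i ≟F q)
    where
    σ-inj : ∀ {j k} → σ ⟨$⟩ʳ j ≡ σ ⟨$⟩ʳ k → j ≡ k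
    σ-inj = permutation-injective σ
    by-cases : Dec (i ≡ p) → Dec (i ≡ q) →
      pick (σ ⟨$⟩ʳ p) (σ ⟨$⟩ʳ q) (σ ⟨$⟩ʳ i) ≡ pick p q i
    by-cases (yes refl) _          = trans (pick-at-p _ _) (sym (pick-at-p p q))
    by-cases (no i≢p)   (yes refl) = trans (pick-at-q _ _ (i≢p ∘ σ-inj)) (sym (pick-at-q p q i≢p))
    by-cases (no i≢p)   (no i≢q)   =
      trans (pick-elsewhere _ _ (i≢p ∘ σ-inj) (i≢q ∘ σ-inj)) (sym (pick-elsewhere p q i≢p i≢q))

  f-pick-< : ∀ {n} {p q : Fin n} → p < q → f (pick p q) ≡ b₁
  f-pick-< {p = p} {q} p<q = f-firstX _ p (pick-at-p p q) (pick-x p q)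
    (λ i i<p pick≡y → y≢z (trans (sym pick≡y)
      (pick-elsewhere p q (<⇒≢ i<p) (<⇒≢ (<-trans i<p p<q)))))

  f-pick-> : ∀ {n} {p q : Fin n} → q < p → f (pick p q) ≡ b₀
  f-pick-> {p = p} {q} q<p = f-firstY _ q (pick-at-q p q (<⇒≢ q<p)) (pick-y p q)
    (λ i i<q pick≡x → x≢z (trans (sym pick≡x)
      (pick-elsewhere p q (<⇒≢ (<-trans i<q q<p)) (<⇒≢ i<q))))

  Inv-strictlyMonotone : ∀ {n} (σ : Permutation′ n) → InInv f σ →
    ∀ {u v} → u < v → σ ⟨$⟩ʳ u < σ ⟨$⟩ʳ v
  Inv-strictlyMonotone σ σ∈Inv {u} {v} u<v with <-cmp (σ ⟨$⟩ʳ u) (σ ⟨$⟩ʳ v)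
  ... | tri< σu<σv _ _ = σu<σv
  ... | tri≈ _ σu≡σv _ = ⊥-elim (<⇒≢ u<v (permutation-injective σ σu≡σv))
  ... | tri> _ _ σv<σu = ⊥-elim (b₀≢b₁ (begin
    b₀                 ≡⟨ f-pick-> u<v ⟨
    f (pick v u)       ≡⟨ f-cong (pick-relabel σ v u) ⟨
    f (pick σv σu · σ) ≡⟨ σ∈Inv (pick σv σu) ⟩
    f (pick σv σu)     ≡⟨ f-pick-< σv<σu ⟩
    b₁                 ∎))
    where
    open ≡-Reasoning
    σu σv : Fin _
    σu = σ ⟨$⟩ʳ u
    σv = σ ⟨$⟩ʳ v

  f-not-twoSetTransitive : ∀ {n} → ¬ TwoSetTransitive (f {suc (suc (suc n))})
  f-not-twoSetTransitive T with T (fsuc fzero) (fsuc (fsuc fzero)) fzero (fsuc fzero) (λ ()) (λ ())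
  ... | σ , σ∈Inv , inj₁ (σ1≡0 , _) =
    n≮0 (subst (σ ⟨$⟩ʳ fzero <_) σ1≡0 (Inv-strictlyMonotone σ σ∈Inv (s<s z≤n)))
  ... | σ , σ∈Inv , inj₂ (σ1≡1 , σ2≡0) =
    n≮0 (subst₂ _<_ σ1≡1 σ2≡0 (Inv-strictlyMonotone σ σ∈Inv (s<s (s<s z≤n))))

  lone-x : ∀ {n} → Tuple A (suc n)
  lone-x fzero    = x
  lone-x (fsuc _) = z

  double-x : ∀ {n} → Tuple A (suc (suc n))
  double-x fzero           = x
  double-x (fsuc fzero)    = x
  double-x (fsuc (fsuc _)) = z

  lone-x≡x : ∀ {n} (i : Fin (suc n)) → lone-x i ≡ x → i ≡ fzero
  lone-x≡x fzero    _    = refl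
  lone-x≡x (fsuc _) z≡x = ⊥-elim (x≢z (sym z≡x))

  lone-x≢y : ∀ {n} (i : Fin (suc n)) → lone-x i ≢ y
  lone-x≢y fzero    = x≢y
  lone-x≢y (fsuc _) = y≢z ∘ sym

  double-x≢y : ∀ {n} (i : Fin (suc (suc n))) → double-x i ≢ y
  double-x≢y fzero           = x≢y
  double-x≢y (fsuc fzero)    = x≢y
  double-x≢y (fsuc (fsuc _)) = y≢z ∘ sym

  ofo-lone-x≡ofo-double-x : ∀ {n} → ofo _≟_ (lone-x {suc (suc n)}) ≡ ofo _≟_ (double-x {suc n})
  ofo-lone-x≡ofo-double-x {n} = begin
    deduplicate _≟_ (x ∷ z ∷ z ∷ zs)
      ≡⟨ deduplicate-∷-cong _≟_ x {z ∷ z ∷ zs} {z ∷ zs} (deduplicate-stutter _≟_ z zs) ⟩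
    deduplicate _≟_ (x ∷ z ∷ zs)
      ≡⟨ deduplicate-stutter _≟_ x (z ∷ zs) ⟨
    deduplicate _≟_ (x ∷ x ∷ z ∷ zs)
      ∎
    where
    open ≡-Reasoning
    zs : List A
    zs = tabulate {n = n} (λ _ → z)

  f-not-similar-to-ofo : ∀ {n} (g : Tuple A (suc (suc (suc n))) → B) →
    DeterminedByOfo _≟_ g → ¬ Similar f g
  f-not-similar-to-ofo {n} g g-ofo (σ , f≡g∘σ) = b₀≢b₁ (begin
    b₀        ≡⟨ f-repeatedX d σ0 σ1 (cong double-x (inverseˡ σ)) (cong double-x (inverseˡ σ))
                   ((λ ()) ∘ permutation-injective σ) (double-x≢y ∘ (σ ⟨$⟩ˡ_)) ⟨
    f d       ≡⟨ f≡g∘σ d ⟩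
    g (d · σ) ≡⟨ g-ofo _ _ ofo-d·σ≡ofo-c·σ ⟩
    g (c · σ) ≡⟨ f≡g∘σ c ⟨
    f c       ≡⟨ f-firstX c σ0 (cong lone-x (inverseˡ σ)) c-unique-x (λ i _ → lone-x≢y (σ ⟨$⟩ˡ i)) ⟩
    b₁        ∎)
    where
    open ≡-Reasoning
    σ0 σ1 : Fin (suc (suc (suc n)))
    σ0 = σ ⟨$⟩ʳ fzero
    σ1 = σ ⟨$⟩ʳ fsuc fzero
    c d : Tuple A (suc (suc (suc n)))
    c = lone-x · flip σ
    d = double-x · flip σ
    c-unique-x : ∀ i → c i ≡ x → i ≡ σ0
    c-unique-x i ci≡x = trans (sym (inverseʳ σ)) (cong (σ ⟨$⟩ʳ_) (lone-x≡x _ ci≡x))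
    ofo-unrelabel : (a : Tuple A (suc (suc (suc n)))) → ofo _≟_ ((a · flip σ) · σ) ≡ ofo _≟_ a
    ofo-unrelabel a = cong (deduplicate _≟_) (tabulate-cong (λ i → cong a (inverseˡ σ {i})))
    ofo-d·σ≡ofo-c·σ : ofo _≟_ (d · σ) ≡ ofo _≟_ (c · σ)
    ofo-d·σ≡ofo-c·σ = begin
      ofo _≟_ (d · σ)                ≡⟨ ofo-unrelabel double-x ⟩
      ofo _≟_ (double-x {suc n})     ≡⟨ ofo-lone-x≡ofo-double-x {n} ⟨
      ofo _≟_ (lone-x {suc (suc n)}) ≡⟨ ofo-unrelabel lone-x ⟨
      ofo _≟_ (c · σ)                ∎

lemma3p6 : (A B : Set) (k : ℕ) (e : A ↔ Fin k) → 3 ≤ k →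
    (b₀ b₁ : B) → b₀ ≢ b₁ →
    (n : ℕ) → suc k ≤ n →
    Σ (Tuple A n → B) λ f →
      DeterminedByCs (inj⇒≟ (↔⇒↣ e)) f ×
      ((g : Tuple A n → B) → DeterminedByOfo (inj⇒≟ (↔⇒↣ e)) g → ¬ Similar f g) ×
      ¬ TwoSetTransitive f
lemma3p6 A B (suc (suc (suc _))) e (s≤s (s≤s (s≤s _))) b₀ b₁ b₀≢b₁
         (suc (suc (suc _))) (s≤s (s≤s (s≤s _))) =
  f , f-determinedByCs , f-not-similar-to-ofo , f-not-twoSetTransitive
  where
  from-injective : ∀ {i j} → Inverse.from e i ≡ Inverse.from e j → i ≡ j
  from-injective = Injection.injective (↔⇒↣ (↔-sym e))
  open Construction (inj⇒≟ (↔⇒↣ e)) b₀≢b₁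
    {Inverse.from e fzero} {Inverse.from e (fsuc fzero)} {Inverse.from e (fsuc (fsuc fzero))}
    ((λ ()) ∘ from-injective) ((λ ()) ∘ from-injective) ((λ ()) ∘ from-injective)
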